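{- Let $G=(A\cup B,E)$ be a finite simple bipartite graph with $|A|=n_1$, $|B|=n_2$, $n=n_1+n_2$, in which every vertex of $B$ has at least one neighbour. Let $\pi$ be a permutation of $A$, i.e. a bijection $\pi:A\to\{1,\dots,n_1\}$. Define $f:A\cup B\to\mathbb{R}$ by $f(v)=\pi(v)$ for $v\in A$ and $f(v)=n+\min_{x\in N(v)}\pi(x)$ for $v\in B$, and let $U(\pi,A,B,G)$ be the graph on vertex set $A\cup B$ in which two distinct vertices $u,v$ are adjacent if and only if $|f(u)-f(v)|\le n$. Then $U(\pi,A,B,G)$ is a supergraph of $G$, i.e. $E(G)\subseteq E(U(\pi,A,B,G))$.
   Context: $N(v)$ denotes the set of neighbours of $v$ in $G$. A graph $G'$ with $V(G')=V(G)$ is a supergraph of $G$ if $E(G)\subseteq E(G')$. -}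

module Defs where

open import Data.Nat using (ℕ; suc; _+_; _⊓_; _≤_; ∣_-_∣)
open import Data.Fin using (Fin; toℕ)
open import Data.Fin.Permutation using (Permutation′; _⟨$⟩ʳ_)
open import Data.Bool using (Bool; true; T)
open import Data.List using (List; map; filter; foldr; allFin)
open import Data.Sum using (_⊎_; inj₁; inj₂)
open import Data.Product using (_×_)
open import Data.Empty using (⊥)
open import Relation.Nullary using (¬_)
open import Relation.Nullary.Decidable using (T?)
open import Relation.Binary.PropositionalEquality using (_≡_)

-- A finite simple bipartite graph with parts A = Fin n₁, B = Fin n₂,
-- given by its (Boolean) biadjacency relation adj a b.
-- Vertex set A ∪ B (disjoint union).
Vertex : ℕ → ℕ → Set
Vertex n₁ n₂ = Fin n₁ ⊎ Fin n₂

GEdge : ∀ {n₁ n₂} → (Fin n₁ → Fin n₂ → Bool) → Vertex n₁ n₂ → Vertex n₁ n₂ → Set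
GEdge adj (inj₁ a) (inj₂ b) = T (adj a b)
GEdge adj (inj₂ b) (inj₁ a) = T (adj a b)
GEdge adj (inj₁ _) (inj₁ _) = ⊥
GEdge adj (inj₂ _) (inj₂ _) = ⊥

-- π as a map A → {1,…,n₁}: πval a = 1 + (position of a under the permutation).
πval : ∀ {n₁} → Permutation′ n₁ → Fin n₁ → ℕ
πval π a = suc (toℕ (π ⟨$⟩ʳ a))

-- min over N(b) of π(x).  The fold starts from n₁, which is ≥ every π-value,
-- so when N(b) is nonempty this is exactly the minimum.
minNbrπ : ∀ {n₁ n₂} → (Fin n₁ → Fin n₂ → Bool) → Permutation′ n₁ → Fin n₂ → ℕ
minNbrπ {n₁} adj π b =
  foldr _⊓_ n₁ (map (πval π) (filter (λ a → T? (adj a b)) (allFin n₁)))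

f : ∀ {n₁ n₂} → (Fin n₁ → Fin n₂ → Bool) → Permutation′ n₁ → Vertex n₁ n₂ → ℕ
f adj π (inj₁ a) = πval π a
f {n₁} {n₂} adj π (inj₂ b) = (n₁ + n₂) + minNbrπ adj π b

UEdge : ∀ {n₁ n₂} → (Fin n₁ → Fin n₂ → Bool) → Permutation′ n₁ →
        Vertex n₁ n₂ → Vertex n₁ n₂ → Set
UEdge {n₁} {n₂} adj π u v = ¬ (u ≡ v) × ∣ f adj π u - f adj π v ∣ ≤ n₁ + n₂

module Submission where

-- Every edge of G joins some a ∈ A to some b ∈ B, so it suffices to show
-- |f(a) − f(b)| ≤ n for such a pair.  Put x = π(a) and m = min_{N(b)} π.
-- Since a ∈ N(b) we have m ≤ x, and since π takes values in {1,…,n₁}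
-- we have x ≤ n₁ ≤ n.  Then f(b) = n + m ≥ x, so
--     |f(a) − f(b)| = n + m − x ≤ n.  The two vertices of an edge lie in different parts,
-- hence are distinct.  (The hypothesis that every b has a neighbour is not
-- needed: the fold's default value n₁ already bounds all π-values.)

open import Defs
open import Data.Nat using (ℕ; _+_; _∸_; _⊓_; _≤_; ∣_-_∣)
open import Data.Nat.Properties
  using (≤-trans; ≤-reflexive; m⊓n≤m; m⊓n≤n; m≤m+n; +-monoʳ-≤; ∸-monoˡ-≤;
         m+n∸n≡m; m≤n⇒∣m-n∣≡n∸m; ∣-∣-comm)
open import Data.Fin using (Fin; toℕ)
open import Data.Fin.Properties using (toℕ<n)
open import Data.Fin.Permutation using (Permutation′; _⟨$⟩ʳ_)
open import Data.Bool using (Bool; T)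
open import Data.Product using (∃; _,_)
open import Data.Sum using (inj₁; inj₂)
open import Data.List using (List; _∷_; foldr; map; filter; allFin)
open import Data.List.Relation.Unary.Any using (here; there)
open import Data.List.Membership.Propositional using (_∈_)
open import Data.List.Membership.Propositional.Properties
  using (∈-map⁺; ∈-filter⁺; ∈-allFin)
open import Relation.Nullary.Decidable using (T?)
open import Relation.Binary.PropositionalEquality using (_≡_; refl; sym; subst)

foldr-⊓-≤-member : ∀ (d x : ℕ) (xs : List ℕ) → x ∈ xs → foldr _⊓_ d xs ≤ x
foldr-⊓-≤-member d x (y ∷ ys) (here refl) = m⊓n≤m y _
foldr-⊓-≤-member d x (y ∷ ys) (there x∈ys) =
  ≤-trans (m⊓n≤n y _) (foldr-⊓-≤-member d x ys x∈ys)

minNbrπ≤πval : ∀ {n₁ n₂} (adj : Fin n₁ → Fin n₂ → Bool) (π : Permutation′ n₁)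
               (a : Fin n₁) (b : Fin n₂) → T (adj a b) → minNbrπ adj π b ≤ πval π a
minNbrπ≤πval {n₁} adj π a b ab = foldr-⊓-≤-member n₁ (πval π a) _
  (∈-map⁺ (πval π) (∈-filter⁺ (λ x → T? (adj x b)) (∈-allFin a) ab))

πval≤n₁ : ∀ {n₁} (π : Permutation′ n₁) (a : Fin n₁) → πval π a ≤ n₁
πval≤n₁ π a = toℕ<n (π ⟨$⟩ʳ a)

∣x-[n+m]∣≤n : ∀ x n m → m ≤ x → x ≤ n → ∣ x - (n + m) ∣ ≤ n
∣x-[n+m]∣≤n x n m m≤x x≤n =
  subst (_≤ n) distance n+m∸x≤n
  where
  distance : n + m ∸ x ≡ ∣ x - (n + m) ∣
  distance = sym (m≤n⇒∣m-n∣≡n∸m (≤-trans x≤n (m≤m+n n m)))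
  n+m∸x≤n : n + m ∸ x ≤ n
  n+m∸x≤n = ≤-trans (∸-monoˡ-≤ x (+-monoʳ-≤ n m≤x)) (≤-reflexive (m+n∸n≡m n x))

∣f[a]-f[b]∣≤n : ∀ {n₁ n₂} (adj : Fin n₁ → Fin n₂ → Bool) (π : Permutation′ n₁)
                (a : Fin n₁) (b : Fin n₂) → T (adj a b) →
                ∣ f adj π (inj₁ a) - f adj π (inj₂ b) ∣ ≤ n₁ + n₂
∣f[a]-f[b]∣≤n {n₁} {n₂} adj π a b ab =
  ∣x-[n+m]∣≤n (πval π a) (n₁ + n₂) (minNbrπ adj π b)
    (minNbrπ≤πval adj π a b ab) (≤-trans (πval≤n₁ π a) (m≤m+n n₁ n₂))

claim1 : (n₁ n₂ : ℕ) (adj : Fin n₁ → Fin n₂ → Bool) →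
    (∀ (b : Fin n₂) → ∃ λ (a : Fin n₁) → T (adj a b)) →
    (π : Permutation′ n₁) →
    ∀ (u v : Vertex n₁ n₂) → GEdge adj u v → UEdge adj π u v
claim1 n₁ n₂ adj _ π (inj₁ a) (inj₂ b) ab = (λ ()) , ∣f[a]-f[b]∣≤n adj π a b ab
claim1 n₁ n₂ adj _ π (inj₂ b) (inj₁ a) ab = (λ ()) ,
  subst (_≤ n₁ + n₂) (∣-∣-comm (f adj π (inj₁ a)) (f adj π (inj₂ b)))
    (∣f[a]-f[b]∣≤n adj π a b ab)
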